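{- Let $D$ be a strongly connected digraph and $T$ a DFS tree of $D$ rooted at $r$. Let $H$ be a connected subdigraph of $T$ and let $G_H$ be the undirected graph with vertex set $V(H)$ in which $uv$ is an edge whenever there is a backward arc (relative to $T$) between $u$ and $v$ in $D$. Then $\chi_A(D\langle V(H)\rangle)\leq\chi(G_H)$, where $D\langle V(H)\rangle$ is the subdigraph of $D$ induced by $V(H)$.
   Context: All digraphs are finite and loopless. Strongly connected: directed path between any ordered pair of distinct vertices. A DFS tree $T$ of $D$ rooted at $r$ is the spanning out-branching produced by depth-first search on $D$ from $r$. $v$ is a descendant of $u$ if there is a directed $uv$-path in $T$; an arc $(u,v)$ of $D$ is a backward arc (relative to $T$) if $u$ is a descendant of $v$. $\chi_A$ denotes the dichromatic number: the minimum number of colors in a vertex coloring whose color classes induce no directed cycle; $\chi$ denotes the chromatic number of an undirected graph. -}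

module Defs where

open import Level using (0ℓ)
open import Data.Nat using (ℕ)
open import Data.Fin using (Fin)
open import Data.Fin.Subset using (Subset; _∈_)
open import Data.Product using (Σ; _×_; _,_)
open import Data.Sum using (_⊎_)
open import Data.List using (List; []; _∷_; _++_)
open import Data.List.Membership.Propositional using () renaming (_∈_ to _∈ˡ_; _∉_ to _∉ˡ_)
open import Relation.Nullary using (¬_)
open import Relation.Binary.PropositionalEquality using (_≡_; _≢_)
open import Relation.Binary.Construct.Closure.ReflexiveTransitive using (Star)
open import Relation.Binary.Construct.Closure.Transitive using (TransClosure)
open import Relation.Binary.Construct.Closure.Symmetric using (SymClosure)

record Digraph (n : ℕ) : Set₁ where
  field
    E         : Fin n → Fin n → Set
    loopless  : ∀ v → ¬ E v v
open Digraph public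

StronglyConnected : ∀ {n} → Digraph n → Set
StronglyConnected {n} D = ∀ (u v : Fin n) → u ≢ v → Star (E D) u v

Arc : ℕ → Set
Arc n = Fin n × Fin n

-- Nondeterministic depth-first search, as an inductive description of its runs.
-- Explore D u S A S' : exploring from the (already visited) vertex u, with
-- visited list S, DFS adds the tree arcs A and ends with visited list S'.
data Explore {n} (D : Digraph n) : Fin n → List (Fin n) → List (Arc n) → List (Fin n) → Set where
  done : ∀ {u S} → (∀ v → E D u v → v ∈ˡ S) → Explore D u S [] S
  step : ∀ {u v S S₁ S₂ A B} → E D u v → v ∉ˡ S →
         Explore D v (v ∷ S) A S₁ → Explore D u S₁ B S₂ →
         Explore D u S ((u , v) ∷ A ++ B) S₂

IsDFSTree : ∀ {n} → Digraph n → Fin n → List (Arc n) → Set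
IsDFSTree {n} D r T = Σ (List (Fin n)) λ S → Explore D r (r ∷ []) T S

TreeArc : ∀ {n} → List (Arc n) → Fin n → Fin n → Set
TreeArc T u v = (u , v) ∈ˡ T

Descendant : ∀ {n} → List (Arc n) → Fin n → Fin n → Set
Descendant T u v = Star (TreeArc T) u v

BackwardArc : ∀ {n} → Digraph n → List (Arc n) → Fin n → Fin n → Set
BackwardArc D T u v = E D u v × Descendant T v u

IsConnectedSubdigraph : ∀ {n} → List (Arc n) → Subset n → (Fin n → Fin n → Set) → Set
IsConnectedSubdigraph {n} T VH AH =
  (∀ u v → AH u v → TreeArc T u v × u ∈ VH × v ∈ VH) ×
  (∀ u v → u ∈ VH → v ∈ VH → Star (SymClosure AH) u v)

GEdge : ∀ {n} → Digraph n → List (Arc n) → Fin n → Fin n → Set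
GEdge D T u v = BackwardArc D T u v ⊎ BackwardArc D T v u

ProperColouring : ∀ {n} → Digraph n → List (Arc n) → (VH : Subset n) → (k : ℕ) →
                  ((v : Fin n) → v ∈ VH → Fin k) → Set
ProperColouring {n} D T VH k c =
  ∀ (u v : Fin n) (hu : u ∈ VH) (hv : v ∈ VH) → GEdge D T u v → c u hu ≢ c v hv

ColourClassArc : ∀ {n} {k} (D : Digraph n) (VH : Subset n) →
                 ((v : Fin n) → v ∈ VH → Fin k) → Fin k → Fin n → Fin n → Set
ColourClassArc D VH c i a b =
  Σ (a ∈ VH) λ ha → Σ (b ∈ VH) λ hb → E D a b × c a ha ≡ i × c b hb ≡ i

AcyclicColouring : ∀ {n} → Digraph n → (VH : Subset n) → (k : ℕ) →
                   ((v : Fin n) → v ∈ VH → Fin k) → Set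
AcyclicColouring {n} D VH k c =
  ∀ (i : Fin k) (v : Fin n) → ¬ TransClosure (ColourClassArc D VH c i) v v

-- List the vertices in reverse order of DFS finishing time. An arc (a , b) of
-- D either ends at a vertex finished before a, or at a vertex that was still
-- on the DFS stack when a finished, i.e. an ancestor of a; in the latter case
-- it is a backward arc. A proper colouring of G_H puts the ends of every
-- backward arc in different classes, so inside a colour class every arc goes
-- strictly forward in this list, and no class contains a directed cycle.
-- Strong connectivity ensures that the search visits every vertex.
module Submission where

open import Defs
open import Level using (_⊔_)
open import Data.Nat using (ℕ)
open import Data.Fin using (Fin; _≟_)
open import Data.Fin.Subset using (Subset; _∈_)
open import Data.List using (List; []; _∷_)
open import Data.List.Relation.Unary.Any using (here; there)
open import Data.List.Membership.Propositional using () renaming (_∈_ to _∈ˡ_)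
open import Data.List.Membership.Propositional.Properties using (∈-++⁺ˡ; ∈-++⁺ʳ)
open import Data.List.Relation.Binary.Subset.Propositional using (_⊆_)
open import Data.Product using (Σ; ∃; _×_; _,_; proj₁; proj₂)
open import Data.Sum using (_⊎_; inj₁; inj₂; map₂)
open import Data.Empty using (⊥-elim)
open import Relation.Nullary using (¬_; yes; no)
open import Relation.Binary.Core using (Rel; _⇒_)
open import Relation.Binary.PropositionalEquality using (refl; sym; trans)
open import Relation.Binary.Construct.Closure.ReflexiveTransitive using (Star; ε; _◅_; _◅◅_; return)
open import Relation.Binary.Construct.Closure.Transitive using (TransClosure; [_]; _∷_)

module _ {a ℓ} {A : Set a} {R : Rel A ℓ} where

  TransClosure⇒Star : TransClosure R ⇒ Star R
  TransClosure⇒Star [ x∼y ]       = return x∼y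
  TransClosure⇒Star (x∼y ∷ y∼⁺z) = x∼y ◅ TransClosure⇒Star y∼⁺z

  Star-closed : ∀ {p} (P : A → Set p) → (∀ {x y} → R x y → P x → P y) →
                ∀ {x y} → Star R x y → P x → P y
  Star-closed P preserved ε           px = px
  Star-closed P preserved (x∼y ◅ y∼⋆z) px = Star-closed P preserved y∼⋆z (preserved x∼y px)

  data TopologicalOrder : List A → Set (a ⊔ ℓ) where
    []  : TopologicalOrder []
    _∷_ : ∀ {x xs} → (∀ {y} → R x y → y ∈ˡ xs) → TopologicalOrder xs →
          TopologicalOrder (x ∷ xs)

  topological-successor : ∀ {xs} → TopologicalOrder xs →
                          ∀ {x y} → x ∈ˡ xs → R x y → y ∈ˡ xs
  topological-successor (later ∷ _)    (here refl) x∼y = there (later x∼y)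
  topological-successor (_ ∷ ordered) (there x∈xs) x∼y =
    there (topological-successor ordered x∈xs x∼y)

  topological-reach-tail : ∀ {x xs} → TopologicalOrder (x ∷ xs) →
                           ∀ {y} → TransClosure R x y → y ∈ˡ xs
  topological-reach-tail (later ∷ _)       [ x∼y ]       = later x∼y
  topological-reach-tail (later ∷ ordered) (x∼y ∷ y∼⁺z) =
    Star-closed (_∈ˡ _) (λ u∼v u∈ → topological-successor ordered u∈ u∼v)
                (TransClosure⇒Star y∼⁺z) (later x∼y)

  topological⇒acyclic : ∀ {xs} → TopologicalOrder xs →
                        ∀ {x} → x ∈ˡ xs → ¬ TransClosure R x x
  topological⇒acyclic ordered@(_ ∷ ordered′) (here refl) cycle =
    topological⇒acyclic ordered′ (topological-reach-tail ordered cycle) cycle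
  topological⇒acyclic (_ ∷ ordered) (there x∈xs) cycle =
    topological⇒acyclic ordered x∈xs cycle

topological-mono : ∀ {a ℓ ℓ′} {A : Set a} {R : Rel A ℓ} {R′ : Rel A ℓ′} → R′ ⇒ R →
                   ∀ {xs} → TopologicalOrder {R = R} xs → TopologicalOrder {R = R′} xs
topological-mono R′⇒R []                = []
topological-mono R′⇒R (later ∷ ordered) =
  (λ x∼y → later (R′⇒R x∼y)) ∷ topological-mono R′⇒R ordered

NonBackwardArc : ∀ {n} → Digraph n → List (Arc n) → Fin n → Fin n → Set
NonBackwardArc D T u v = E D u v × ¬ Descendant T v u

module DFS {n : ℕ} (D : Digraph n) (T : List (Arc n)) where

  Ancestors : List (Fin n) → Fin n → Set
  Ancestors G u = ∀ {g} → g ∈ˡ G → Descendant T g u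

  -- The state of a search with stack G (the vertices being explored),
  -- visited vertices S and finished vertices B, latest first.
  record Invariant (G S B : List (Fin n)) : Set where
    field
      topological     : TopologicalOrder {R = NonBackwardArc D T} B
      visited         : ∀ {w} → w ∈ˡ S → w ∈ˡ B ⊎ w ∈ˡ G
      finished-closed : ∀ {u w} → u ∈ˡ B → E D u w → w ∈ˡ S

  open Invariant

  explore-visited-mono : ∀ {u S A S′} → Explore D u S A S′ → S ⊆ S′
  explore-visited-mono (done _)            w∈S = w∈S
  explore-visited-mono (step _ _ sub rest) w∈S =
    explore-visited-mono rest (explore-visited-mono sub (there w∈S))

  explore-saturates : ∀ {u S A S′} → Explore D u S A S′ → ∀ {w} → E D u w → w ∈ˡ S′
  explore-saturates (done saturated)  e = saturated _ e
  explore-saturates (step _ _ _ rest) e = explore-saturates rest e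

  enter : ∀ {G S B} v → Invariant G S B → Invariant (v ∷ G) (v ∷ S) B
  enter v inv = record
    { topological     = topological inv
    ; visited         = λ { (here refl) → inj₂ (here refl)
                          ; (there w∈S) → map₂ there (visited inv w∈S) }
    ; finished-closed = λ u∈B e → there (finished-closed inv u∈B e)
    }

  finish : ∀ {G S B v} → Invariant (v ∷ G) S B → Ancestors G v →
           (∀ {w} → E D v w → w ∈ˡ S) → Invariant G S (v ∷ B)
  finish {G} {S} {B} {v} inv ancestors saturated = record
    { topological     = forward ∷ topological inv
    ; visited         = visited′
    ; finished-closed = λ { (here refl) e → saturated e
                          ; (there u∈B) e → finished-closed inv u∈B e }
    }
    where
    forward : ∀ {w} → NonBackwardArc D T v w → w ∈ˡ B
    forward (e , non-backward) with visited inv (saturated e)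
    ... | inj₁ w∈B         = w∈B
    ... | inj₂ (here refl) = ⊥-elim (loopless D v e)
    ... | inj₂ (there w∈G) = ⊥-elim (non-backward (ancestors w∈G))

    visited′ : ∀ {w} → w ∈ˡ S → w ∈ˡ v ∷ B ⊎ w ∈ˡ G
    visited′ w∈S with visited inv w∈S
    ... | inj₁ w∈B         = inj₁ (there w∈B)
    ... | inj₂ (here refl) = inj₁ (here refl)
    ... | inj₂ (there w∈G) = inj₂ w∈G

  explore-invariant : ∀ {u S A S′} → Explore D u S A S′ → A ⊆ T →
                      ∀ {G B} → Ancestors G u → Invariant G S B → ∃ (Invariant G S′)
  explore-invariant (done _) _ _ inv = _ , inv
  explore-invariant (step {v = v} _ _ sub rest) A⊆T {G} ancestors inv =
    explore-invariant rest (λ a∈A₂ → A⊆T (there (∈-++⁺ʳ _ a∈A₂))) ancestors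
      (finish (proj₂ (explore-invariant sub (λ a∈A₁ → A⊆T (there (∈-++⁺ˡ a∈A₁)))
                                          ancestors-on-stack (enter v inv)))
              ancestors-of-v (explore-saturates sub))
    where
    ancestors-of-v : Ancestors G v
    ancestors-of-v g∈G = ancestors g∈G ◅◅ return (A⊆T (here refl))

    ancestors-on-stack : Ancestors (v ∷ G) v
    ancestors-on-stack (here refl) = ε
    ancestors-on-stack (there g∈G) = ancestors-of-v g∈G

  dfs-topological-order : StronglyConnected D → ∀ {r} → IsDFSTree D r T →
                          ∃ λ L → TopologicalOrder {R = NonBackwardArc D T} L × (∀ v → v ∈ˡ L)
  dfs-topological-order strong {r} (S , search) = _ , topological final , listed
    where
    initial : Invariant (r ∷ []) (r ∷ []) []
    initial = record { topological = [] ; visited = inj₂ ; finished-closed = λ () }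

    root-ancestors : Ancestors (r ∷ []) r
    root-ancestors (here refl) = ε

    searched : ∃ (Invariant (r ∷ []) S)
    searched = explore-invariant search (λ a∈T → a∈T) root-ancestors initial

    final : Invariant [] S (r ∷ proj₁ searched)
    final = finish (proj₂ searched) (λ ()) (explore-saturates search)

    listed-visited : ∀ {w} → w ∈ˡ S → w ∈ˡ r ∷ _
    listed-visited w∈S with visited final w∈S
    ... | inj₁ w∈L = w∈L

    r∈S : r ∈ˡ S
    r∈S = explore-visited-mono search (here refl)

    reached : ∀ v → v ∈ˡ S
    reached v with r ≟ v
    ... | yes refl = r∈S
    ... | no r≢v   = Star-closed (_∈ˡ S) (λ e u∈S → finished-closed final (listed-visited u∈S) e)
                                 (strong r v r≢v) r∈S

    listed : ∀ v → v ∈ˡ _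
    listed v = listed-visited (reached v)

colour-class-non-backward : ∀ {n} (D : Digraph n) (T : List (Arc n)) {VH : Subset n} {k}
                            {c : (v : Fin n) → v ∈ VH → Fin k} → ProperColouring D T VH k c →
                            ∀ i → ColourClassArc D VH c i ⇒ NonBackwardArc D T
colour-class-non-backward D T proper i (ha , hb , e , ca , cb) =
  e , λ b⇝a → proper _ _ ha hb (inj₁ (e , b⇝a)) (trans ca (sym cb))

lemma2 : ∀ {n} (D : Digraph n) → StronglyConnected D →
    (r : Fin n) (T : List (Arc n)) → IsDFSTree D r T →
    (VH : Subset n) (AH : Fin n → Fin n → Set) → IsConnectedSubdigraph T VH AH →
    (k : ℕ) (c : (v : Fin n) → v ∈ VH → Fin k) → ProperColouring D T VH k c →
    Σ ((v : Fin n) → v ∈ VH → Fin k) λ c′ → AcyclicColouring D VH k c′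
lemma2 D strong r T dfs VH _ _ k c proper = c , acyclic
  where
  open DFS D T using (dfs-topological-order)

  acyclic : AcyclicColouring D VH k c
  acyclic i v =
    let _ , ordered , listed = dfs-topological-order strong dfs
    in topological⇒acyclic (topological-mono (colour-class-non-backward D T proper i) ordered)
                           (listed v)
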